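{- Let $\ell$ be an odd prime. For any integers $a$ and $b$, $$T_\ell(a)\equiv T_\ell(b)\pmod{\ell^2}\quad\text{if and only if}\quad a\equiv b\pmod{\ell}.$$
   Context: $T_\ell(x)$ is the Chebyshev polynomial of the first kind of degree $\ell$, i.e. the unique monic polynomial with $T_\ell(z+z^{ -1})=z^\ell+z^{ -\ell}$; it has integer coefficients. -}

module Defs where

open import Data.Nat using (ℕ; zero; suc)
open import Data.Integer using (ℤ; +_; _-_; _*_)
open import Data.Integer.Divisibility using (_∣_)

-- T n x : evaluation at the integer x of the degree-n monic Chebyshev
-- polynomial characterised by T n (z + z⁻¹) = zⁿ + z⁻ⁿ.
-- Recurrence: T 0 = 2, T 1 = x, T (n+2) = x * T (n+1) - T n
-- (from (z+z⁻¹)(zⁿ⁺¹+z⁻⁽ⁿ⁺¹⁾) = (zⁿ⁺²+z⁻⁽ⁿ⁺²⁾) + (zⁿ+z⁻ⁿ)).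
T : ℕ → ℤ → ℤ
T zero x = + 2
T (suc zero) x = x
T (suc (suc n)) x = x * T (suc n) x - T n x

_≡_[mod_] : ℤ → ℤ → ℕ → Set
a ≡ b [mod m ] = (+ m) ∣ (a - b)

module Submission where

-- In ℤ[z]/(z² - x z + 1) the element z is a unit with z + z⁻¹ = x, so T ℓ x = z^ℓ + z^(-ℓ).
-- The freshman's dream (z + z⁻¹)^ℓ ≡ z^ℓ + z^(-ℓ) (mod ℓ) and Fermat's little theorem give
-- T ℓ x ≡ x^ℓ ≡ x (mod ℓ), so T ℓ a ≡ T ℓ b (mod ℓ²) forces a ≡ b (mod ℓ).
-- Conversely T ℓ′ = ℓ U_(ℓ-1), so in the Taylor expansion of T ℓ at b with step h = a - b ∈ ℓℤ
-- both the linear term h ℓ U_(ℓ-1)(b) and the O(h²) remainder are divisible by ℓ².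

open import Defs
open import Algebra.Bundles using (CommutativeSemiring)
open import Data.Fin as Fin using (Fin; fromℕ; inject₁)
open import Data.Fin.Patterns using (0F)
open import Data.Fin.Properties using (toℕ-fromℕ; inject₁ℕ<)
open import Data.Nat as ℕ using (ℕ; zero; suc; _<_; _≤_; _!; s≤s; z≤n)
open import Data.Nat.Combinatorics using (_C_; nCn≡1; nCk≡n!/k![n-k]!; k![n∸k]!∣n!)
import Data.Nat.Divisibility as ℕ
open import Data.Nat.DivMod using (m/n*n≡m)
open import Data.Nat.Primality using (Prime; euclidsLemma; prime⇒nonTrivial)
import Data.Nat.Properties as ℕₚ
open import Data.Product using (∃-syntax; _,_; proj₁; proj₂)
open import Data.Sum using (inj₁; inj₂)
open import Data.Vec.Functional using (Vector; init; tail)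
open import Relation.Nullary using (¬_; contradiction)
open import Relation.Binary.PropositionalEquality as ≡ using (_≡_; cong)

nCk*k![n∸k]!≡n! : ∀ {n k} → k ≤ n → (n C k) ℕ.* (k ! ℕ.* (n ℕ.∸ k) !) ≡ n !
nCk*k![n∸k]!≡n! {n} {k} k≤n =
  ≡.trans (cong (ℕ._* (k ! ℕ.* (n ℕ.∸ k) !)) (nCk≡n!/k![n-k]! k≤n))
        (m/n*n≡m {{ℕₚ._!*_!≢0 k (n ℕ.∸ k)}} (k![n∸k]!∣n! k≤n))

prime∤! : ∀ {p m} → Prime p → m < p → ¬ p ℕ.∣ m !
prime∤! {m = zero} p-prime _ p∣1 =
  contradiction (ℕ.∣1⇒≡1 p∣1) (ℕ.nonTrivial⇒≢1 {{prime⇒nonTrivial p-prime}})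
prime∤! {m = suc m} p-prime m<p p∣m! with euclidsLemma (suc m) (m !) p-prime p∣m!
... | inj₁ p∣1+m = ℕₚ.<⇒≱ m<p (ℕ.∣⇒≤ p∣1+m)
... | inj₂ p∣m!  = prime∤! p-prime (ℕₚ.<⇒≤ m<p) p∣m!

prime∣pCk : ∀ {p k} → Prime p → 0 < k → k < p → p ℕ.∣ p C k
prime∣pCk {suc m} {k} p-prime 0<k k<p
  with euclidsLemma (suc m C k) (k ! ℕ.* (suc m ℕ.∸ k) !) p-prime
         (ℕ.∣-trans (ℕ.m∣m*n (m !)) (ℕ.∣-reflexive (≡.sym (nCk*k![n∸k]!≡n! (ℕₚ.<⇒≤ k<p)))))
... | inj₁ p∣pCk = p∣pCk
... | inj₂ p∣k!*[p∸k]! with euclidsLemma (k !) ((suc m ℕ.∸ k) !) p-prime p∣k!*[p∸k]!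
...   | inj₁ p∣k!     = contradiction p∣k! (prime∤! p-prime k<p)
...   | inj₂ p∣[p∸k]! = contradiction p∣[p∸k]! (prime∤! p-prime (ℕₚ.∸-monoʳ-< 0<k (ℕₚ.<⇒≤ k<p)))

module FreshmansDream {c ℓ} (R : CommutativeSemiring c ℓ) where

  open CommutativeSemiring R hiding (refl)
  open import Algebra.Properties.CommutativeSemiring.Binomial R using (binomialTerm; theorem)
  open import Algebra.Properties.Semiring.Exp semiring using (_^_)
  open import Algebra.Properties.Monoid.Sum +-monoid using (sum; sum-cong-≋; sum-init-last)
  open import Algebra.Properties.Monoid.Mult +-monoid using (_×_; ×-homo-0; ×-homo-1; ×-assocˡ)
  open import Algebra.Properties.CommutativeMonoid.Mult +-commutativeMonoid using (×-distrib-+)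
  open import Relation.Binary.Reasoning.Setoid setoid

  ×-zeroʳ : ∀ m → m × 0# ≈ 0#
  ×-zeroʳ zero    = ×-homo-0 0#
  ×-zeroʳ (suc m) = trans (+-identityˡ _) (×-zeroʳ m)

  ×-distrib-sum : ∀ m {n} (f : Vector Carrier n) → sum (λ i → m × f i) ≈ m × sum f
  ×-distrib-sum m {zero}  f = sym (×-zeroʳ m)
  ×-distrib-sum m {suc n} f = begin
    m × f 0F + sum (λ i → m × tail f i) ≈⟨ +-congˡ (×-distrib-sum m (tail f)) ⟩
    m × f 0F + m × sum (tail f)         ≈⟨ ×-distrib-+ _ _ m ⟨
    m × sum f                           ∎

  binomialTerm-first : ∀ x y n → binomialTerm x y n 0F ≈ y ^ n
  binomialTerm-first x y n = trans (×-homo-1 _) (*-identityˡ _)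

  binomialTerm-last : ∀ x y n → binomialTerm x y n (fromℕ n) ≈ x ^ n
  binomialTerm-last x y n rewrite toℕ-fromℕ n | nCn≡1 n | ℕₚ.n∸n≡0 n =
    trans (×-homo-1 _) (*-identityʳ _)

  binomialTerm-inner : ∀ {m} → Prime (suc m) → ∀ x y (i : Fin m) →
    ∃[ r ] binomialTerm x y (suc m) (Fin.suc (inject₁ i)) ≈ suc m × r
  binomialTerm-inner {m} p-prime x y i with prime∣pCk p-prime (s≤s z≤n) (s≤s (inject₁ℕ< i))
  ... | ℕ.divides q pCk≡q*p = q × b , (begin
    (p C k) × b     ≡⟨ cong (_× b) pCk≡q*p ⟩
    (q ℕ.* p) × b   ≡⟨ cong (_× b) (ℕₚ.*-comm q p) ⟩
    (p ℕ.* q) × b   ≈⟨ ×-assocˡ b p q ⟨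
    p × (q × b)     ∎)
    where
    p = suc m
    k = suc (Fin.toℕ (inject₁ i))
    b = x ^ k * y ^ (p ℕ.∸ k)

  freshmansDream : ∀ {p} → Prime p → ∀ x y → ∃[ r ] (x + y) ^ p ≈ x ^ p + y ^ p + p × r
  freshmansDream {suc m} p-prime x y = r , (begin
    (x + y) ^ p                                ≈⟨ theorem p x y ⟩
    t 0F + sum (tail t)                        ≈⟨ +-congˡ (sum-init-last (tail t)) ⟩
    t 0F + (sum (init (tail t)) + t (fromℕ p)) ≈⟨ +-cong (binomialTerm-first x y p)
                                                    (+-cong inner (binomialTerm-last x y p)) ⟩
    y ^ p + (p × r + x ^ p)                    ≈⟨ +-congˡ (+-comm _ _) ⟩
    y ^ p + (x ^ p + p × r)                    ≈⟨ +-assoc _ _ _ ⟨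
    y ^ p + x ^ p + p × r                      ≈⟨ +-congʳ (+-comm _ _) ⟩
    x ^ p + y ^ p + p × r                      ∎)
    where
    p = suc m
    t = binomialTerm x y p
    r = sum (λ i → proj₁ (binomialTerm-inner p-prime x y i))
    inner : sum (init (tail t)) ≈ p × r
    inner = trans (sum-cong-≋ (λ i → proj₂ (binomialTerm-inner p-prime x y i)))
                  (×-distrib-sum p (λ i → proj₁ (binomialTerm-inner p-prime x y i)))

module Chebyshev where

  open import Algebra.Structures using (IsCommutativeSemiring)
  open import Algebra.Structures.Biased using (isCommutativeSemiringˡ; isCommutativeMonoidˡ)
  open import Data.Integer as ℤ using (ℤ; +_; -[1+_]; _+_; _-_; _*_; -_)
  open import Data.Integer.Divisibility.Signed using (_∣_; divides; ∣-trans; ∣m∣n⇒∣m+n; ∣m∣n⇒∣m-n)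
  import Data.Integer.Properties as ℤₚ
  open import Data.Integer.Tactic.RingSolver using (solve-∀; solve)
  open import Data.List using (_∷_; [])
  open import Algebra.Properties.Monoid.Mult ℤₚ.+-0-monoid using (_×_)
  open import Algebra.Properties.Semiring.Exp ℤₚ.+-*-semiring using (_^_)
  open import Level using (0ℓ)
  open import Relation.Binary.PropositionalEquality using (refl; cong₂; module ≡-Reasoning)
  open import Relation.Binary.PropositionalEquality.Algebra using (isMagma)
  open ≡-Reasoning

  -- U n is the Chebyshev polynomial of the second kind U_(n-1): U n (z + z⁻¹) = (zⁿ - z⁻ⁿ) / (z - z⁻¹).
  U : ℕ → ℤ → ℤ
  U zero          x = + 0
  U (suc zero)    x = + 1
  U (suc (suc n)) x = x * U (suc n) x - U n x

  T≡U-U : ∀ n x → T (suc n) x ≡ U (suc (suc n)) x - U n x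
  T≡U-U zero          x = begin
    x                         ≡⟨ solve (x ∷ []) ⟩
    x * + 1 - + 0 - + 0       ∎
  T≡U-U (suc zero)    x = begin
    x * x - + 2               ≡⟨ solve (x ∷ []) ⟩
    x * (x * + 1 - + 0) - + 1 - + 1 ∎
  T≡U-U (suc (suc n)) x = begin
    x * T (suc (suc n)) x - T (suc n) x
      ≡⟨ cong₂ (λ t t′ → x * t - t′) (T≡U-U (suc n) x) (T≡U-U n x) ⟩
    x * (U₃ - U₁) - (U₂ - U₀)
      ≡⟨ ring x U₃ U₂ U₁ U₀ ⟩
    (x * U₃ - U₂) - (x * U₁ - U₀) ∎
    where
    U₀ = U n x
    U₁ = U (suc n) x
    U₂ = U (suc (suc n)) x
    U₃ = U (suc (suc (suc n))) x
    ring : ∀ x a b c d → x * (a - c) - (b - d) ≡ (x * a - b) - (x * c - d)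
    ring = solve-∀

  -- + n * U n x is the derivative T n′(x), and this is the recurrence of T differentiated.
  T′-recurrence : ∀ n x →
    T (suc n) x + x * (+ suc n * U (suc n) x) - + n * U n x ≡ + suc (suc n) * U (suc (suc n)) x
  T′-recurrence n x = begin
    T (suc n) x + x * (+ suc n * U₁) - + n * U₀
      ≡⟨ cong (λ t → t + x * (+ suc n * U₁) - + n * U₀) (T≡U-U n x) ⟩
    (x * U₁ - U₀) - U₀ + x * ((+ 1 + + n) * U₁) - + n * U₀
      ≡⟨ ring x (+ n) U₁ U₀ ⟩
    (+ 2 + + n) * (x * U₁ - U₀) ∎
    where
    U₀ = U n x
    U₁ = U (suc n) x
    ring : ∀ x m a b → (x * a - b) - b + x * ((+ 1 + m) * a) - m * b ≡ (+ 2 + m) * (x * a - b)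
    ring = solve-∀

  T-taylor : ∀ n x h → ∃[ r ] T n (x + h) ≡ T n x + h * (+ n * U n x) + h * h * r
  T-taylor zero          x h = + 0 , ring h
    where
    ring : ∀ h → + 2 ≡ + 2 + h * (+ 0 * + 0) + h * h * + 0
    ring = solve-∀
  T-taylor (suc zero)    x h = + 0 , ring x h
    where
    ring : ∀ x h → x + h ≡ x + h * (+ 1 * + 1) + h * h * + 0
    ring = solve-∀
  T-taylor (suc (suc n)) x h with T-taylor (suc n) x h | T-taylor n x h
  ... | r₁ , e₁ | r₀ , e₀ = r , (begin
    (x + h) * T (suc n) (x + h) - T n (x + h)
      ≡⟨ cong₂ (λ t t′ → (x + h) * t - t′) e₁ e₀ ⟩
    (x + h) * (T₁ + h * D₁ + h * h * r₁) - (T₀ + h * D₀ + h * h * r₀)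
      ≡⟨ ring x h T₁ T₀ D₁ D₀ r₁ r₀ ⟩
    (x * T₁ - T₀) + h * (T₁ + x * D₁ - D₀) + h * h * r
      ≡⟨ cong (λ d → (x * T₁ - T₀) + h * d + h * h * r) (T′-recurrence n x) ⟩
    (x * T₁ - T₀) + h * (+ suc (suc n) * U (suc (suc n)) x) + h * h * r ∎)
    where
    T₀ = T n x
    T₁ = T (suc n) x
    D₀ = + n * U n x
    D₁ = + suc n * U (suc n) x
    r  = D₁ + (x + h) * r₁ - r₀
    ring : ∀ x h t₁ t₀ d₁ d₀ r₁ r₀ →
      (x + h) * (t₁ + h * d₁ + h * h * r₁) - (t₀ + h * d₀ + h * h * r₀)
        ≡ (x * t₁ - t₀) + h * (t₁ + x * d₁ - d₀) + h * h * (d₁ + (x + h) * r₁ - r₀)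
    ring = solve-∀

  T-lift : ∀ n {a b} → + n ∣ a - b → + n * + n ∣ T n a - T n b
  T-lift n {a} {b} (divides q a-b≡qn) with T-taylor n b (q * + n)
  ... | r , taylor = divides (q * U n b + q * q * r) (begin
    T n a - T n b
      ≡⟨ cong (λ a → T n a - T n b) (≡.trans (a≡b+[a-b] a b) (cong (λ d → b + d) a-b≡qn)) ⟩
    T n (b + q * + n) - T n b
      ≡⟨ cong (_- T n b) taylor ⟩
    T n b + q * + n * (+ n * U n b) + q * + n * (q * + n) * r - T n b
      ≡⟨ ring (T n b) q (+ n) (U n b) r ⟩
    (q * U n b + q * q * r) * (+ n * + n) ∎)
    where
    a≡b+[a-b] : ∀ a b → a ≡ b + (a - b)
    a≡b+[a-b] = solve-∀
    ring : ∀ t q n u r → t + q * n * (n * u) + q * n * (q * n) * r - t ≡ (q * u + q * q * r) * (n * n)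
    ring = solve-∀

  ℤ-induction : ∀ {ℓ} {P : ℤ → Set ℓ} →
    P (+ 0) → (∀ a → P a → P (+ 1 + a)) → (∀ a → P (+ 1 + a) → P a) → ∀ a → P a
  ℤ-induction base up down (+ zero)      = base
  ℤ-induction base up down (+ suc n)     = up (+ n) (ℤ-induction base up down (+ n))
  ℤ-induction base up down -[1+ zero ]   = down -[1+ 0 ] base
  ℤ-induction base up down -[1+ suc n ]  = down -[1+ suc n ] (ℤ-induction base up down -[1+ n ])

  1^n≡1 : ∀ n → (+ 1) ^ n ≡ + 1
  1^n≡1 zero    = refl
  1^n≡1 (suc n) = ≡.trans (ℤₚ.*-identityˡ _) (1^n≡1 n)

  ×≡* : ∀ n a → n × a ≡ + n * a
  ×≡* zero    a = ≡.sym (ℤₚ.*-zeroˡ a)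
  ×≡* (suc n) a = ≡.trans (cong (λ m → a + m) (×≡* n a)) (≡.sym (ℤₚ.suc-* (+ n) a))

  module _ {p} (p-prime : Prime p) where

    open FreshmansDream ℤₚ.+-*-commutativeSemiring using (freshmansDream)

    [1+a]^p≡1+a^p-mod-prime : ∀ a → + p ∣ (+ 1 + a) ^ p - (+ 1 + a ^ p)
    [1+a]^p≡1+a^p-mod-prime a with freshmansDream p-prime (+ 1) a
    ... | r , dream = divides r (begin
      (+ 1 + a) ^ p - (+ 1 + a ^ p)
        ≡⟨ cong (_- (+ 1 + a ^ p)) dream ⟩
      (+ 1) ^ p + a ^ p + p × r - (+ 1 + a ^ p)
        ≡⟨ cong₂ (λ o m → o + a ^ p + m - (+ 1 + a ^ p)) (1^n≡1 p) (×≡* p r) ⟩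
      + 1 + a ^ p + + p * r - (+ 1 + a ^ p)
        ≡⟨ ring (a ^ p) (+ p) r ⟩
      r * + p ∎)
      where
      ring : ∀ b p r → + 1 + b + p * r - (+ 1 + b) ≡ r * p
      ring = solve-∀

    fermat : ∀ a → + p ∣ a ^ p - a
    fermat = ℤ-induction base up down
      where
      up : ∀ a → + p ∣ a ^ p - a → + p ∣ (+ 1 + a) ^ p - (+ 1 + a)
      up a p∣ = ≡.subst (+ p ∣_) (ring ((+ 1 + a) ^ p) (a ^ p) a)
        (∣m∣n⇒∣m+n ([1+a]^p≡1+a^p-mod-prime a) p∣)
        where
        ring : ∀ c b a → (c - (+ 1 + b)) + (b - a) ≡ c - (+ 1 + a)
        ring = solve-∀
      down : ∀ a → + p ∣ (+ 1 + a) ^ p - (+ 1 + a) → + p ∣ a ^ p - a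
      down a p∣ = ≡.subst (+ p ∣_) (ring ((+ 1 + a) ^ p) (a ^ p) a)
        (∣m∣n⇒∣m-n p∣ ([1+a]^p≡1+a^p-mod-prime a))
        where
        ring : ∀ c b a → (c - (+ 1 + a)) - (c - (+ 1 + b)) ≡ b - a
        ring = solve-∀
      base : + p ∣ (+ 0) ^ p - + 0
      base = down (+ 0) (divides (+ 0) (cong (_- + 1) (1^n≡1 p)))

  -- ⟪ a , b ⟫ stands for a + b z in ℤ[z]/(z² - x z + 1), where z⁻¹ = x - z.
  module QuadraticRing (x : ℤ) where

    data ℤ[z] : Set where
      ⟪_,_⟫ : ℤ → ℤ → ℤ[z]

    infixl 6 _⊕_
    infixl 7 _⊗_

    _⊕_ : ℤ[z] → ℤ[z] → ℤ[z]
    ⟪ a , b ⟫ ⊕ ⟪ c , d ⟫ = ⟪ a + c , b + d ⟫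

    _⊗_ : ℤ[z] → ℤ[z] → ℤ[z]
    ⟪ a , b ⟫ ⊗ ⟪ c , d ⟫ = ⟪ a * c - b * d , a * d + b * c + x * (b * d) ⟫

    𝟘 𝟙 : ℤ[z]
    𝟘 = ⟪ + 0 , + 0 ⟫
    𝟙 = ⟪ + 1 , + 0 ⟫

    ⊕-assoc : ∀ u v w → (u ⊕ v) ⊕ w ≡ u ⊕ (v ⊕ w)
    ⊕-assoc ⟪ a , b ⟫ ⟪ c , d ⟫ ⟪ e , f ⟫ = cong₂ ⟪_,_⟫ (solve (a ∷ c ∷ e ∷ [])) (solve (b ∷ d ∷ f ∷ []))

    ⊕-identityˡ : ∀ u → 𝟘 ⊕ u ≡ u
    ⊕-identityˡ ⟪ a , b ⟫ = cong₂ ⟪_,_⟫ (solve (a ∷ [])) (solve (b ∷ []))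

    ⊕-comm : ∀ u v → u ⊕ v ≡ v ⊕ u
    ⊕-comm ⟪ a , b ⟫ ⟪ c , d ⟫ = cong₂ ⟪_,_⟫ (solve (a ∷ c ∷ [])) (solve (b ∷ d ∷ []))

    ⊗-assoc : ∀ u v w → (u ⊗ v) ⊗ w ≡ u ⊗ (v ⊗ w)
    ⊗-assoc ⟪ a , b ⟫ ⟪ c , d ⟫ ⟪ e , f ⟫ =
      cong₂ ⟪_,_⟫ (solve (x ∷ a ∷ b ∷ c ∷ d ∷ e ∷ f ∷ [])) (solve (x ∷ a ∷ b ∷ c ∷ d ∷ e ∷ f ∷ []))

    ⊗-identityˡ : ∀ u → 𝟙 ⊗ u ≡ u
    ⊗-identityˡ ⟪ a , b ⟫ = cong₂ ⟪_,_⟫ (solve (a ∷ b ∷ [])) (solve (x ∷ a ∷ b ∷ []))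

    ⊗-comm : ∀ u v → u ⊗ v ≡ v ⊗ u
    ⊗-comm ⟪ a , b ⟫ ⟪ c , d ⟫ = cong₂ ⟪_,_⟫ (solve (a ∷ b ∷ c ∷ d ∷ [])) (solve (x ∷ a ∷ b ∷ c ∷ d ∷ []))

    ⊗-distribʳ-⊕ : ∀ u v w → (v ⊕ w) ⊗ u ≡ v ⊗ u ⊕ w ⊗ u
    ⊗-distribʳ-⊕ ⟪ a , b ⟫ ⟪ c , d ⟫ ⟪ e , f ⟫ =
      cong₂ ⟪_,_⟫ (solve (a ∷ b ∷ c ∷ d ∷ e ∷ f ∷ [])) (solve (x ∷ a ∷ b ∷ c ∷ d ∷ e ∷ f ∷ []))

    ⊗-zeroˡ : ∀ u → 𝟘 ⊗ u ≡ 𝟘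
    ⊗-zeroˡ ⟪ a , b ⟫ = cong₂ ⟪_,_⟫ (solve (a ∷ b ∷ [])) (solve (x ∷ a ∷ b ∷ []))

    isCommutativeSemiring : IsCommutativeSemiring _≡_ _⊕_ _⊗_ 𝟘 𝟙
    isCommutativeSemiring = isCommutativeSemiringˡ record
      { +-isCommutativeMonoid = isCommutativeMonoidˡ record
        { isSemigroup = record { isMagma = isMagma _⊕_ ; assoc = ⊕-assoc }
        ; identityˡ   = ⊕-identityˡ
        ; comm        = ⊕-comm
        }
      ; *-isCommutativeMonoid = isCommutativeMonoidˡ record
        { isSemigroup = record { isMagma = isMagma _⊗_ ; assoc = ⊗-assoc }
        ; identityˡ   = ⊗-identityˡ
        ; comm        = ⊗-comm
        }
      ; distribʳ = ⊗-distribʳ-⊕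
      ; zeroˡ    = ⊗-zeroˡ
      }

    commutativeSemiring : CommutativeSemiring 0ℓ 0ℓ
    commutativeSemiring = record { isCommutativeSemiring = isCommutativeSemiring }

    open import Algebra.Properties.Semiring.Exp (CommutativeSemiring.semiring commutativeSemiring)
      using () renaming (_^_ to _↑_)
    open import Algebra.Properties.Monoid.Mult (CommutativeSemiring.+-monoid commutativeSemiring)
      using () renaming (_×_ to _·_)

    z z⁻¹ : ℤ[z]
    z   = ⟪ + 0 , + 1 ⟫
    z⁻¹ = ⟪ x , - + 1 ⟫

    ι : ℤ → ℤ[z]
    ι a = ⟪ a , + 0 ⟫

    z+z⁻¹≡x : z ⊕ z⁻¹ ≡ ι x
    z+z⁻¹≡x = cong₂ ⟪_,_⟫ (ℤₚ.+-identityˡ x) (ℤₚ.+-inverseʳ (+ 1))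

    z↑ : ∀ n → z ↑ suc n ≡ ⟪ - U n x , U (suc n) x ⟫
    z↑ zero    = cong₂ ⟪_,_⟫ refl (ring x)
      where
      ring : ∀ x → + 0 * + 0 + + 1 * + 1 + x * (+ 1 * + 0) ≡ + 1
      ring = solve-∀
    z↑ (suc n) = ≡.trans (cong (z ⊗_) (z↑ n))
      (cong₂ ⟪_,_⟫ (ring₁ (U n x) (U (suc n) x)) (ring₂ x (U n x) (U (suc n) x)))
      where
      ring₁ : ∀ u₀ u₁ → + 0 * - u₀ - + 1 * u₁ ≡ - u₁
      ring₁ = solve-∀
      ring₂ : ∀ x u₀ u₁ → + 0 * u₁ + + 1 * - u₀ + x * (+ 1 * u₁) ≡ x * u₁ - u₀
      ring₂ = solve-∀

    z⁻¹↑ : ∀ n → z⁻¹ ↑ suc n ≡ ⟪ U (suc (suc n)) x , - U (suc n) x ⟫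
    z⁻¹↑ zero    = cong₂ ⟪_,_⟫ (ring₁ x) (ring₂ x)
      where
      ring₁ : ∀ x → x * + 1 - - + 1 * + 0 ≡ x * + 1 - + 0
      ring₁ = solve-∀
      ring₂ : ∀ x → x * + 0 + - + 1 * + 1 + x * (- + 1 * + 0) ≡ - + 1
      ring₂ = solve-∀
    z⁻¹↑ (suc n) = ≡.trans (cong (z⁻¹ ⊗_) (z⁻¹↑ n))
      (cong₂ ⟪_,_⟫ (ring₁ x (U (suc n) x) (U (suc (suc n)) x)) (ring₂ x (U (suc n) x) (U (suc (suc n)) x)))
      where
      ring₁ : ∀ x u₁ u₂ → x * u₂ - - + 1 * - u₁ ≡ x * u₂ - u₁
      ring₁ = solve-∀
      ring₂ : ∀ x u₁ u₂ → x * - u₁ + - + 1 * u₂ + x * (- + 1 * - u₁) ≡ - u₂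
      ring₂ = solve-∀

    z↑+z⁻¹↑≡T : ∀ n → z ↑ n ⊕ z⁻¹ ↑ n ≡ ι (T n x)
    z↑+z⁻¹↑≡T zero    = refl
    z↑+z⁻¹↑≡T (suc n) = begin
      z ↑ suc n ⊕ z⁻¹ ↑ suc n
        ≡⟨ cong₂ _⊕_ (z↑ n) (z⁻¹↑ n) ⟩
      ⟪ - U n x + U (suc (suc n)) x , U (suc n) x + - U (suc n) x ⟫
        ≡⟨ cong₂ ⟪_,_⟫ (ℤₚ.+-comm (- U n x) _) (ℤₚ.+-inverseʳ (U (suc n) x)) ⟩
      ⟪ U (suc (suc n)) x - U n x , + 0 ⟫
        ≡⟨ cong ι (≡.sym (T≡U-U n x)) ⟩
      ι (T (suc n) x) ∎

    ι↑ : ∀ a n → ι a ↑ n ≡ ι (a ^ n)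
    ι↑ a zero    = refl
    ι↑ a (suc n) = ≡.trans (cong (ι a ⊗_) (ι↑ a n))
      (cong₂ ⟪_,_⟫ (ring₁ a (a ^ n)) (ring₂ x a (a ^ n)))
      where
      ring₁ : ∀ a b → a * b - + 0 * + 0 ≡ a * b
      ring₁ = solve-∀
      ring₂ : ∀ x a b → a * + 0 + + 0 * b + x * (+ 0 * + 0) ≡ + 0
      ring₂ = solve-∀

    ·-⟪⟫ : ∀ n a b → n · ⟪ a , b ⟫ ≡ ⟪ + n * a , + n * b ⟫
    ·-⟪⟫ zero    a b = cong₂ ⟪_,_⟫ (≡.sym (ℤₚ.*-zeroˡ a)) (≡.sym (ℤₚ.*-zeroˡ b))
    ·-⟪⟫ (suc n) a b = ≡.trans (cong (⟪ a , b ⟫ ⊕_) (·-⟪⟫ n a b))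
      (cong₂ ⟪_,_⟫ (≡.sym (ℤₚ.suc-* (+ n) a)) (≡.sym (ℤₚ.suc-* (+ n) b)))

    open FreshmansDream commutativeSemiring using (freshmansDream)

    pow≡T-mod-prime : ∀ {p} → Prime p → + p ∣ x ^ p - T p x
    pow≡T-mod-prime {p} p-prime with freshmansDream p-prime z z⁻¹
    ... | ⟪ r₁ , r₂ ⟫ , dream = divides r₁ (begin
      x ^ p - T p x                  ≡⟨ cong (λ a → a - T p x) (cong re lift) ⟩
      T p x + + p * r₁ - T p x      ≡⟨ ring (T p x) (+ p) r₁ ⟩
      r₁ * + p                       ∎)
      where
      re : ℤ[z] → ℤ
      re ⟪ a , _ ⟫ = a
      lift : ι (x ^ p) ≡ ι (T p x) ⊕ ⟪ + p * r₁ , + p * r₂ ⟫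
      lift = begin
        ι (x ^ p)                               ≡⟨ ≡.sym (ι↑ x p) ⟩
        ι x ↑ p                                 ≡⟨ cong (_↑ p) (≡.sym z+z⁻¹≡x) ⟩
        (z ⊕ z⁻¹) ↑ p                          ≡⟨ dream ⟩
        z ↑ p ⊕ z⁻¹ ↑ p ⊕ p · ⟪ r₁ , r₂ ⟫      ≡⟨ cong₂ _⊕_ (z↑+z⁻¹↑≡T p) (·-⟪⟫ p r₁ r₂) ⟩
        ι (T p x) ⊕ ⟪ + p * r₁ , + p * r₂ ⟫    ∎
      ring : ∀ t p r → t + p * r - t ≡ r * p
      ring = solve-∀

  T≡id-mod-prime : ∀ {p} → Prime p → ∀ a → + p ∣ T p a - a
  T≡id-mod-prime {p} p-prime a = ≡.subst (+ p ∣_) (ring (a ^ p) (T p a) a)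
    (∣m∣n⇒∣m-n (fermat p-prime a) (QuadraticRing.pow≡T-mod-prime a p-prime))
    where
    ring : ∀ c t a → (c - a) - (c - t) ≡ t - a
    ring = solve-∀

  T-injective-mod-prime : ∀ {p a b} → Prime p → + p * + p ∣ T p a - T p b → + p ∣ a - b
  T-injective-mod-prime {p} {a} {b} p-prime p²∣ = ≡.subst (+ p ∣_) (ring (T p a) (T p b) a b)
    (∣m∣n⇒∣m+n (∣m∣n⇒∣m-n (∣-trans (divides (+ p) refl) p²∣) (T≡id-mod-prime p-prime a))
               (T≡id-mod-prime p-prime b))
    where
    ring : ∀ s t a b → (s - t) - (s - a) + (t - b) ≡ a - b
    ring = solve-∀

open import Data.Integer using (ℤ; +_; _-_; _*_)
open import Data.Integer.Divisibility.Signed using (_∣_; ∣ᵤ⇒∣; ∣⇒∣ᵤ)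
import Data.Integer.Properties as ℤₚ
open import Data.Nat using (_^_)
open import Data.Product using (_×_)
open Chebyshev using (T-lift; T-injective-mod-prime)

+[n^2]≡+n*+n : ∀ n → + (n ^ 2) ≡ + n * + n
+[n^2]≡+n*+n n = ≡.trans (ℤₚ.pos-* n (n ℕ.* 1)) (cong (λ m → + n * + m) (ℕₚ.*-identityʳ n))

-- The argument does not need ℓ ≢ 2.
proposition3p4 : (ℓ : ℕ) → Prime ℓ → ¬ (ℓ ≡ 2) → (a b : ℤ) →
    (T ℓ a ≡ T ℓ b [mod ℓ ^ 2 ] → a ≡ b [mod ℓ ]) × (a ≡ b [mod ℓ ] → T ℓ a ≡ T ℓ b [mod ℓ ^ 2 ])
proposition3p4 ℓ ℓ-prime _ a b =
  (λ ℓ²∣ → ∣⇒∣ᵤ (T-injective-mod-prime ℓ-prime (≡.subst (_∣ T ℓ a - T ℓ b) ℓ² (∣ᵤ⇒∣ ℓ²∣)))) ,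
  (λ ℓ∣ → ∣⇒∣ᵤ (≡.subst (_∣ T ℓ a - T ℓ b) (≡.sym ℓ²) (T-lift ℓ (∣ᵤ⇒∣ ℓ∣))))
  where
  ℓ² : + (ℓ ^ 2) ≡ + ℓ * + ℓ
  ℓ² = +[n^2]≡+n*+n ℓ
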